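{- Fix an integer $s\ge0$, and let $i\ge1$ and $1\le r\le 2^{i-1}$. (a) If $v_s(n)$ is the super-node $s_i$, then $a_s(n)=2^{i-1}$. (b) If $v_s(n)$ is the $r$th child of $s_i$ (a level 1 node), then $a_s(n)=2^{i-1}+r-1$. (c) If $v_s(n)$ is the level 2 node whose parent is the $r$th child of $s_i$, then $a_s(n)=2^{i-1}+r$.
   Context: Fix an integer $s\ge 0$. Let $\mathcal{T}_s$ be the following infinite graph. It has super-nodes (level 0 nodes) $s_1,s_2,s_3,\dots$, with $s_{i+1}$ adjacent to $s_i$ for each $i\ge1$. Each super-node $s_i$ has $2^{i-1}$ children (level 1 nodes), called in left-to-right order the 1st, 2nd, $\dots$, $2^{i-1}$th child of $s_i$. Each level 1 node has exactly one child, a level 2 node, and level 2 nodes have no children. In addition there is one isolated node $I$. The leaves of $\mathcal{T}_s$ are the level 2 nodes together with $I$. Nodes are labelled by positive integers as follows: $I$ gets label $1$; then for $i=1,2,3,\dots$ in turn, the super-node $s_i$ receives the next $s$ consecutive unused labels (no label at all if $s=0$), and then for $r=1,2,\dots,2^{i-1}$ in turn, the $r$th child of $s_i$ receives the next unused label and then its child (a leaf) receives the next unused label. Thus each positive integer labels exactly one node. For $n\ge1$ let $v_s(n)$ be the node with label $n$, let $d_s(n)=1$ if $v_s(n)$ is a leaf and $d_s(n)=0$ otherwise, and let $a_s(n)=\sum_{k=1}^n d_s(k)$. -}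

module Defs where

open import Data.Nat using (ℕ; zero; suc; _+_; _∸_; _^_)
open import Data.List using (List; []; _∷_; _++_; replicate; concat; map; applyUpTo)

-- I          : the isolated node
--   super i    : the super-node s_i                         (i ≥ 1)
--   child i r  : the r-th child of s_i (level 1)            (1 ≤ r ≤ 2^(i-1))
--   leaf i r   : the level 2 node whose parent is child i r
data Node : Set where
  I     : Node
  super : ℕ → Node
  child : ℕ → ℕ → Node
  leaf  : ℕ → ℕ → Node

isLeaf : Node → ℕ
isLeaf I           = 1
isLeaf (super _)   = 0
isLeaf (child _ _) = 0
isLeaf (leaf _ _)  = 1

-- the sequence of labels handed out while processing super-node s_i:
-- s copies of s_i, then (r-th child, its leaf) for r = 1 .. 2^(i-1)
block : ℕ → ℕ → List Node
block s i = replicate s (super i)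
         ++ concat (map (λ r → child i r ∷ leaf i r ∷ []) (applyUpTo suc (2 ^ (i ∸ 1))))

-- labels 1, 2, 3, ... assigned in order: I, then block 1, block 2, ..., block k
labelsUpTo : ℕ → ℕ → List Node
labelsUpTo s k = I ∷ concat (map (λ j → block s (suc j)) (applyUpTo (λ j → j) k))

-- index into a list (0-based), default I when out of range
index : List Node → ℕ → Node
index []       _       = I
index (x ∷ _)  zero    = x
index (_ ∷ xs) (suc m) = index xs m

-- v_s(n): the node with label n (n ≥ 1). The list labelsUpTo s n has
-- more than n entries (each block has ≥ 2), so the n-th label is in it.
v : ℕ → ℕ → Node
v s n = index (labelsUpTo s n) (n ∸ 1)

d : ℕ → ℕ → ℕ
d s n = isLeaf (v s n)

a : ℕ → ℕ → ℕ
a s zero    = 0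
a s (suc n) = a s n + d s (suc n)

module Submission where

-- Reading the label sequence I, block 1, block 2, ... from the left,
-- every node x is met exactly when the running number of leaves seen so
-- far (x included) equals an explicit value  predictedCount x ; Lemma 2.2
-- is this statement read at the node v_s(n), since that running number
-- is a_s(n).

open import Defs
open import Data.Nat using (ℕ; zero; suc; _+_; _∸_; _^_; _≤_; _<_; _≤′_; ≤′-refl; ≤′-step; z≤n; s≤s)
open import Data.Nat.Properties
open import Data.Nat.ListAction using (sum)
open import Data.Nat.ListAction.Properties using (sum-++)
open import Data.Product using (_×_; _,_; ∃)
open import Data.List using (List; []; _∷_; _++_; _∷ʳ_; [_]; replicate; concat; map; applyUpTo; length; take)
open import Data.List.Properties using (applyUpTo-∷ʳ; map-++; concat-++; ++-identityʳ; ++-assoc; length-++)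
open import Relation.Binary.PropositionalEquality using (_≡_; refl; sym; trans; cong; cong₂; subst; module ≡-Reasoning)

-- The value of a_s at the label of a node, as claimed by Lemma 2.2
-- (the isolated node I carries label 1 and is itself a leaf).
predictedCount : Node → ℕ
predictedCount I           = 1
predictedCount (super i)   = 2 ^ (i ∸ 1)
predictedCount (child i r) = 2 ^ (i ∸ 1) + r ∸ 1
predictedCount (leaf i r)  = 2 ^ (i ∸ 1) + r

leafCount : List Node → ℕ
leafCount xs = sum (map isLeaf xs)

leafCount-++ : ∀ xs ys → leafCount (xs ++ ys) ≡ leafCount xs + leafCount ys
leafCount-++ xs ys = trans (cong sum (map-++ isLeaf xs ys)) (sum-++ (map isLeaf xs) (map isLeaf ys))

leafCount≤length : ∀ xs → leafCount xs ≤ length xs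
leafCount≤length []                = z≤n
leafCount≤length (I ∷ xs)          = s≤s (leafCount≤length xs)
leafCount≤length (super _ ∷ xs)    = m≤n⇒m≤1+n (leafCount≤length xs)
leafCount≤length (child _ _ ∷ xs)  = m≤n⇒m≤1+n (leafCount≤length xs)
leafCount≤length (leaf _ _ ∷ xs)   = s≤s (leafCount≤length xs)

leafCount-take-suc : ∀ xs p → p < length xs →
  leafCount (take (suc p) xs) ≡ leafCount (take p xs) + isLeaf (index xs p)
leafCount-take-suc (x ∷ xs) zero    _         = +-identityʳ (isLeaf x)
leafCount-take-suc (x ∷ xs) (suc p) (s≤s p<n) =
  trans (cong (isLeaf x +_) (leafCount-take-suc xs p p<n))
        (sym (+-assoc (isLeaf x) _ _))

index-++ : ∀ xs ys p → p < length xs → index (xs ++ ys) p ≡ index xs p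
index-++ (x ∷ xs) ys zero    _         = refl
index-++ (x ∷ xs) ys (suc p) (s≤s p<n) = index-++ xs ys p p<n

-- Consistent C xs: when xs is read after C leaves have already been seen,
-- each node x is reached with running leaf count (x included) equal to
-- predictedCount x.
data Consistent : ℕ → List Node → Set where
  []  : ∀ {C} → Consistent C []
  _∷_ : ∀ {C x xs} → C + isLeaf x ≡ predictedCount x →
        Consistent (C + isLeaf x) xs → Consistent C (x ∷ xs)

consistent-++ : ∀ {C} xs {ys} → Consistent C xs →
  Consistent (C + leafCount xs) ys → Consistent C (xs ++ ys)
consistent-++ {C} []           []         cys = subst (λ D → Consistent D _) (+-identityʳ C) cys
consistent-++ {C} (x ∷ xs) {ys} (cx ∷ cxs) cys = cx ∷ consistent-++ xs cxs
  (subst (λ D → Consistent D ys) (sym (+-assoc C (isLeaf x) (leafCount xs))) cys)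

consistent-lookup : ∀ {C xs} → Consistent C xs → ∀ q → q < length xs →
  C + leafCount (take q xs) + isLeaf (index xs q) ≡ predictedCount (index xs q)
consistent-lookup {C} (cx ∷ _) zero _ = trans (cong (_+ _) (+-identityʳ C)) cx
consistent-lookup {C} {x ∷ xs} (_ ∷ cxs) (suc q) (s≤s q<n) =
  trans (cong (_+ isLeaf (index xs q)) (sym (+-assoc C (isLeaf x) _)))
        (consistent-lookup cxs q q<n)

supers-consistent : ∀ s i {C} → C ≡ 2 ^ (i ∸ 1) → Consistent C (replicate s (super i))
supers-consistent zero    i     _  = []
supers-consistent (suc s) i {C} eq =
  let eq′ = trans (+-identityʳ C) eq in eq′ ∷ supers-consistent s i eq′

leafCount-supers : ∀ s i → leafCount (replicate s (super i)) ≡ 0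
leafCount-supers zero    i = refl
leafCount-supers (suc s) i = leafCount-supers s i

levelOne : ℕ → List ℕ → List Node
levelOne i rs = concat (map (λ r → child i r ∷ leaf i r ∷ []) rs)

-- Each child/leaf pair adds exactly one leaf.
leafCount-levelOne : ∀ i f m → leafCount (levelOne i (applyUpTo f m)) ≡ m
leafCount-levelOne i f zero    = refl
leafCount-levelOne i f (suc m) = cong suc (leafCount-levelOne i (λ j → f (suc j)) m)

levelOne-consistent : ∀ i m c f {C} → (∀ j → f j ≡ suc (c + j)) →
  C ≡ 2 ^ (i ∸ 1) + c → Consistent C (levelOne i (applyUpTo f m))
levelOne-consistent i zero    c f hf hC = []
levelOne-consistent i (suc m) c f {C} hf hC =
  atChild ∷ (atLeaf ∷ levelOne-consistent i m (suc c) (λ j → f (suc j)) hf′ atLeaf′)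
  where
  open ≡-Reasoning
  base = 2 ^ (i ∸ 1)
  f0 : f 0 ≡ suc c
  f0 = trans (hf 0) (cong suc (+-identityʳ c))
  atLeaf′ : C + 0 + 1 ≡ base + suc c
  atLeaf′ = begin
    C + 0 + 1   ≡⟨ cong (_+ 1) (+-identityʳ C) ⟩
    C + 1       ≡⟨ +-comm C 1 ⟩
    suc C       ≡⟨ cong suc hC ⟩
    suc (base + c) ≡⟨ sym (+-suc base c) ⟩
    base + suc c ∎
  atChild : C + 0 ≡ base + f 0 ∸ 1
  atChild = begin
    C + 0               ≡⟨ +-identityʳ C ⟩
    C                   ≡⟨ hC ⟩
    base + c            ≡⟨ cong (_∸ 1) (sym (+-suc base c)) ⟩
    base + suc c ∸ 1    ≡⟨ cong (λ r → base + r ∸ 1) (sym f0) ⟩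
    base + f 0 ∸ 1      ∎
  atLeaf : C + 0 + 1 ≡ base + f 0
  atLeaf = trans atLeaf′ (cong (base +_) (sym f0))
  hf′ : ∀ j → f (suc j) ≡ suc (suc c + j)
  hf′ j = trans (hf (suc j)) (cong suc (+-suc c j))

block-consistent : ∀ s i {C} → C ≡ 2 ^ (i ∸ 1) → Consistent C (block s i)
block-consistent s i {C} eq =
  consistent-++ (replicate s (super i)) (supers-consistent s i eq)
    (levelOne-consistent i (2 ^ (i ∸ 1)) 0 suc (λ _ → refl) start)
  where
  start : C + leafCount (replicate s (super i)) ≡ 2 ^ (i ∸ 1) + 0
  start = trans (cong (C +_) (leafCount-supers s i))
                (trans (+-identityʳ C) (trans eq (sym (+-identityʳ _))))

leafCount-block : ∀ s i → leafCount (block s i) ≡ 2 ^ (i ∸ 1)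
leafCount-block s i = begin
  leafCount (block s i)
    ≡⟨ leafCount-++ (replicate s (super i)) (levelOne i (applyUpTo suc (2 ^ (i ∸ 1)))) ⟩
  leafCount (replicate s (super i)) + leafCount (levelOne i (applyUpTo suc (2 ^ (i ∸ 1))))
    ≡⟨ cong₂ _+_ (leafCount-supers s i) (leafCount-levelOne i suc (2 ^ (i ∸ 1))) ⟩
  2 ^ (i ∸ 1) ∎
  where open ≡-Reasoning

labels-suc : ∀ s k → labelsUpTo s (suc k) ≡ labelsUpTo s k ++ block s (suc k)
labels-suc s k = cong (I ∷_) (begin
    concat (map g (applyUpTo id (suc k)))
  ≡⟨ cong (λ js → concat (map g js)) (sym (applyUpTo-∷ʳ id k)) ⟩
    concat (map g (applyUpTo id k ∷ʳ k))
  ≡⟨ cong concat (map-++ g (applyUpTo id k) [ k ]) ⟩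
    concat (map g (applyUpTo id k) ++ [ g k ])
  ≡⟨ sym (concat-++ (map g (applyUpTo id k)) [ g k ]) ⟩
    concat (map g (applyUpTo id k)) ++ (g k ++ [])
  ≡⟨ cong (concat (map g (applyUpTo id k)) ++_) (++-identityʳ (g k)) ⟩
    concat (map g (applyUpTo id k)) ++ g k ∎)
  where
  open ≡-Reasoning
  id : ℕ → ℕ
  id j = j
  g : ℕ → List Node
  g j = block s (suc j)

leafCount-labels : ∀ s k → leafCount (labelsUpTo s k) ≡ 2 ^ k
leafCount-labels s zero    = refl
leafCount-labels s (suc k) = begin
  leafCount (labelsUpTo s (suc k))
    ≡⟨ cong leafCount (labels-suc s k) ⟩
  leafCount (labelsUpTo s k ++ block s (suc k))
    ≡⟨ leafCount-++ (labelsUpTo s k) (block s (suc k)) ⟩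
  leafCount (labelsUpTo s k) + leafCount (block s (suc k))
    ≡⟨ cong₂ _+_ (leafCount-labels s k) (leafCount-block s (suc k)) ⟩
  2 ^ k + 2 ^ k
    ≡⟨ cong (2 ^ k +_) (sym (+-identityʳ (2 ^ k))) ⟩
  2 ^ suc k ∎
  where open ≡-Reasoning

labels-consistent : ∀ s k → Consistent 0 (labelsUpTo s k)
labels-consistent s zero    = refl ∷ []
labels-consistent s (suc k) = subst (Consistent 0) (sym (labels-suc s k))
  (consistent-++ (labelsUpTo s k) (labels-consistent s k)
    (block-consistent s (suc k) (leafCount-labels s k)))

-- The list of labels up to block k has more than k entries, since each
-- block contains at least one leaf.
labels-long : ∀ s k → k < length (labelsUpTo s k)
labels-long s zero    = s≤s z≤n
labels-long s (suc k) = begin-strict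
  suc k                                                      ≤⟨ labels-long s k ⟩
  length (labelsUpTo s k)                                    <⟨ m<m+n _ blockNonEmpty ⟩
  length (labelsUpTo s k) + length (block s (suc k))         ≡⟨ sym (length-++ (labelsUpTo s k)) ⟩
  length (labelsUpTo s k ++ block s (suc k))                 ≡⟨ cong length (sym (labels-suc s k)) ⟩
  length (labelsUpTo s (suc k))                              ∎
  where
  open ≤-Reasoning
  blockNonEmpty : 0 < length (block s (suc k))
  blockNonEmpty = ≤-trans (≤-trans (m^n>0 2 k) (≤-reflexive (sym (leafCount-block s (suc k)))))
                          (leafCount≤length (block s (suc k)))

labels-prefix : ∀ s {k m} → k ≤′ m → ∃ λ ys → labelsUpTo s m ≡ labelsUpTo s k ++ ys
labels-prefix s ≤′-refl = [] , sym (++-identityʳ _)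
labels-prefix s {k} (≤′-step {m} k≤′m) with labels-prefix s k≤′m
... | ys , eq = ys ++ block s (suc m) , (begin
    labelsUpTo s (suc m)                    ≡⟨ labels-suc s m ⟩
    labelsUpTo s m ++ block s (suc m)       ≡⟨ cong (_++ block s (suc m)) eq ⟩
    (labelsUpTo s k ++ ys) ++ block s (suc m) ≡⟨ ++-assoc (labelsUpTo s k) ys _ ⟩
    labelsUpTo s k ++ ys ++ block s (suc m) ∎)
  where open ≡-Reasoning

label-stable : ∀ s {p k} → p < k → index (labelsUpTo s k) p ≡ v s (suc p)
label-stable s {p} p<k with labels-prefix s (≤⇒≤′ p<k)
... | ys , eq = trans (cong (λ xs → index xs p) eq)
                      (index-++ (labelsUpTo s (suc p)) ys p (<⇒≤ (labels-long s (suc p))))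

a-as-leafCount : ∀ s {n k} → n ≤ k → a s n ≡ leafCount (take n (labelsUpTo s k))
a-as-leafCount s {zero}      _     = refl
a-as-leafCount s {suc n} {k} n<k = begin
  a s n + isLeaf (v s (suc n))
    ≡⟨ cong₂ _+_ (a-as-leafCount s (<⇒≤ n<k)) (cong isLeaf (sym (label-stable s n<k))) ⟩
  leafCount (take n L) + isLeaf (index L n)
    ≡⟨ sym (leafCount-take-suc L n (<-≤-trans n<k (<⇒≤ (labels-long s k)))) ⟩
  leafCount (take (suc n) L) ∎
  where
  open ≡-Reasoning
  L = labelsUpTo s k

count-correct : ∀ s n → 1 ≤ n → a s n ≡ predictedCount (v s n)
count-correct s (suc n) _ =
  trans (cong (_+ isLeaf (index L n)) (a-as-leafCount s (n≤1+n n)))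
        (consistent-lookup (labels-consistent s (suc n)) n
          (<-≤-trans (n<1+n n) (<⇒≤ (labels-long s (suc n)))))
  where
  L = labelsUpTo s (suc n)

lemma2p2 : (s i : ℕ) → 1 ≤ i →
    ((n : ℕ) → 1 ≤ n → v s n ≡ super i → a s n ≡ 2 ^ (i ∸ 1))
    × ((r n : ℕ) → 1 ≤ r → r ≤ 2 ^ (i ∸ 1) → 1 ≤ n →
        v s n ≡ child i r → a s n ≡ 2 ^ (i ∸ 1) + r ∸ 1)
    × ((r n : ℕ) → 1 ≤ r → r ≤ 2 ^ (i ∸ 1) → 1 ≤ n →
        v s n ≡ leaf i r → a s n ≡ 2 ^ (i ∸ 1) + r)
lemma2p2 s i _ =
    (λ n n≥1 eq → countAt n n≥1 eq)
  , (λ r n _ _ n≥1 eq → countAt n n≥1 eq)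
  , (λ r n _ _ n≥1 eq → countAt n n≥1 eq)
  where
  countAt : ∀ {x} n → 1 ≤ n → v s n ≡ x → a s n ≡ predictedCount x
  countAt n n≥1 eq = trans (count-correct s n n≥1) (cong predictedCount eq)
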